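{- Every freshness context $\nabla$ (a finite set of NLA-freshness constraints) is equivalent to a finite disjunction of simple freshness contexts, i.e. there are simple freshness contexts $\nabla_1,\dots,\nabla_k$ such that for every interpretation $\rho$: $\nabla\rho$ holds if and only if $\nabla_i\rho$ holds for some $i\in\{1,\dots,k\}$.
   Context: Fix a countably infinite set of atoms, a signature of function symbols, and disjoint countably infinite sets of term-variables $X,Y,\dots$ and atom-variables $A,B,\dots$. NLA-terms: $s::=W\mid\pi\cdot X\mid f(s_1,\dots,s_n)\mid\lambda W.s$, with atom suspensions $W::=\pi\cdot A$ and permutations $\pi::=\mathit{id}\mid(W_1\,W_2)\circ\pi$. An NLA-freshness constraint is $W\#s$; a freshness context is a finite set of them. An interpretation $\rho$ maps atom-variables to atoms (not necessarily injectively) and term-variables to ground terms (terms $a\mid f(S_1..S_n)\mid\lambda a.S$ over atoms), extended homomorphically, with $(W_1\,W_2)\circ\pi$ interpreted as the swapping of the atoms $W_1\rho,W_2\rho$ composed with $\pi\rho$. For ground terms, $a\#S$ means $a$ does not occur free in $S$; $\nabla\rho$ holds iff $W\rho\#s\rho$ holds for all $W\#s\in\nabla$. A simple freshness context is a set of constraints of the forms $A\#B$, $A\#X$, or $A\#\lambda B.A$ (the latter holds under $\rho$ iff $A\rho=B\rho$, abbreviated $A=B$), where $A,B$ are atom-variables and $X$ is a term-variable. -}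

module Defs where

open import Data.Nat using (ℕ; _≟_)
open import Data.Vec using (Vec; []; _∷_)
open import Data.List using (List; map)
open import Data.List.Relation.Unary.All using (All)
open import Data.List.Relation.Unary.Any using (Any)
open import Data.Product using (_×_)
open import Relation.Nullary using (¬_; yes; no)
open import Relation.Binary.PropositionalEquality using (_≡_; _≢_)

-- Atoms, atom-variables and term-variables are each represented by ℕ
-- (countably infinite, and the three sorts are kept apart by typing).
Atom : Set
Atom = ℕ

AVar : Set
AVar = ℕ

TVar : Set
TVar = ℕ

record Signature : Set₁ where
  field
    Sym   : Set
    arity : Sym → ℕ
open Signature public

mutual
  data ASusp : Set where
    _·ᵃ_ : Perm → AVar → ASusp

  data Perm : Set where
    idπ    : Perm
    swap∘ : ASusp → ASusp → Perm → Perm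

swapAtom : Atom → Atom → Atom → Atom
swapAtom a b c with c ≟ a
... | yes _ = b
... | no _ with c ≟ b
...   | yes _ = a
...   | no _  = c

module _ (S : Signature) where

  data Term : Set where
    atm : ASusp → Term
    sus : Perm → TVar → Term
    fn  : (f : Sym S) → Vec Term (arity S f) → Term
    lam : ASusp → Term → Term

  data Ground : Set where
    gatm : Atom → Ground
    gfn  : (f : Sym S) → Vec Ground (arity S f) → Ground
    glam : Atom → Ground → Ground

  mutual
    data FreeIn (a : Atom) : Ground → Set where
      free-atm : FreeIn a (gatm a)
      free-fn  : ∀ {f} {ts : Vec Ground (arity S f)} → FreeInVec a ts → FreeIn a (gfn f ts)
      free-lam : ∀ {b t} → a ≢ b → FreeIn a t → FreeIn a (glam b t)

    data FreeInVec (a : Atom) : ∀ {n} → Vec Ground n → Set where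
      here  : ∀ {n t} {ts : Vec Ground n} → FreeIn a t → FreeInVec a (t ∷ ts)
      there : ∀ {n t} {ts : Vec Ground n} → FreeInVec a ts → FreeInVec a (t ∷ ts)

  _#g_ : Atom → Ground → Set
  a #g t = ¬ FreeIn a t

  mutual
    permG : (Atom → Atom) → Ground → Ground
    permG p (gatm a)   = gatm (p a)
    permG p (gfn f ts) = gfn f (permGs p ts)
    permG p (glam a t) = glam (p a) (permG p t)

    permGs : (Atom → Atom) → ∀ {n} → Vec Ground n → Vec Ground n
    permGs p []       = []
    permGs p (t ∷ ts) = permG p t ∷ permGs p ts

  record Interp : Set where
    field
      atomI : AVar → Atom
      termI : TVar → Ground
  open Interp public

  mutual
    ⟦_⟧ᵃ : ASusp → Interp → Atom
    ⟦ π ·ᵃ A ⟧ᵃ ρ = ⟦ π ⟧ᵖ ρ (atomI ρ A)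

    ⟦_⟧ᵖ : Perm → Interp → Atom → Atom
    ⟦ idπ ⟧ᵖ ρ c = c
    ⟦ swap∘ W₁ W₂ π ⟧ᵖ ρ c = swapAtom (⟦ W₁ ⟧ᵃ ρ) (⟦ W₂ ⟧ᵃ ρ) (⟦ π ⟧ᵖ ρ c)

  mutual
    ⟦_⟧ : Term → Interp → Ground
    ⟦ atm W ⟧ ρ   = gatm (⟦ W ⟧ᵃ ρ)
    ⟦ sus π X ⟧ ρ = permG (⟦ π ⟧ᵖ ρ) (termI ρ X)
    ⟦ fn f ss ⟧ ρ = gfn f (⟦ ss ⟧ˢ ρ)
    ⟦ lam W s ⟧ ρ = glam (⟦ W ⟧ᵃ ρ) (⟦ s ⟧ ρ)

    ⟦_⟧ˢ : ∀ {n} → Vec Term n → Interp → Vec Ground n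
    ⟦ [] ⟧ˢ ρ     = []
    ⟦ s ∷ ss ⟧ˢ ρ = ⟦ s ⟧ ρ ∷ ⟦ ss ⟧ˢ ρ

  record Constraint : Set where
    constructor _#_
    field
      lhs : ASusp
      rhs : Term

  -- freshness contexts (finite sets, represented as lists)
  FreshCtx : Set
  FreshCtx = List Constraint

  HoldsC : Constraint → Interp → Set
  HoldsC (W # s) ρ = ⟦ W ⟧ᵃ ρ #g ⟦ s ⟧ ρ

  Holds : FreshCtx → Interp → Set
  Holds ∇ ρ = All (λ c → HoldsC c ρ) ∇

  data SimpleConstraint : Set where
    av#av  : AVar → AVar → SimpleConstraint
    av#tv  : AVar → TVar → SimpleConstraint
    av#lam : AVar → AVar → SimpleConstraint

  embed : SimpleConstraint → Constraint
  embed (av#av A B)  = (idπ ·ᵃ A) # atm (idπ ·ᵃ B)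
  embed (av#tv A X)  = (idπ ·ᵃ A) # sus idπ X
  embed (av#lam A B) = (idπ ·ᵃ A) # lam (idπ ·ᵃ B) (atm (idπ ·ᵃ A))

  SimpleCtx : Set
  SimpleCtx = List SimpleConstraint

  toCtx : SimpleCtx → FreshCtx
  toCtx = map embed

{-# OPTIONS --safe #-}

-- Freshness in a ground term decomposes structurally: a # f(S₁,…,Sₙ) iff
-- a # Sᵢ for every i, a # λb.S iff a = b or a # S, a # b iff a ≠ b, and
-- a # π·X iff π⁻¹(a) # X.  What is left are atom suspensions π·A.  The
-- value of a suspension is always the value of one of the atom-variables
-- occurring in it, namely the one singled out by the equalities and
-- disequalities between those variables, and both A = B (as A # λB.A) and
-- A ≠ B (as A # B) are simple constraints.  Case splitting on them and
-- distributing ∧ over ∨ turns every context into a disjunction of simple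
-- contexts.

module Submission where

open import Defs
open import Data.Empty using (⊥-elim)
open import Data.List using (List; []; _∷_; [_]; _++_; cartesianProductWith)
open import Data.List.Properties using (map-++)
open import Data.List.Relation.Unary.All using ([]; _∷_; uncons)
import Data.List.Relation.Unary.All.Properties as All
open import Data.List.Relation.Unary.Any using (Any; here)
import Data.List.Relation.Unary.Any.Properties as Any
open import Data.Nat using (_≟_)
open import Data.Product using (Σ; _×_; _,_; proj₂; uncurry)
open import Data.Product.Function.NonDependent.Propositional using (_×-⇔_)
open import Data.Sum using (_⊎_; inj₁; inj₂; [_,_]′)
open import Data.Sum.Function.Propositional using (_⊎-⇔_)
open import Data.Vec using (Vec; []; _∷_)
open import Function using (_∘_)
open import Function.Bundles using (_⇔_; mk⇔; module Equivalence)
import Function.Properties.Equivalence as ⇔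
open import Function.Properties.Inverse using (↔⇒⇔)
open import Function.Related.TypeIsomorphisms using (¬-cong-⇔)
open import Relation.Nullary using (¬_; yes; no; contradiction)
open import Relation.Binary.PropositionalEquality
  using (_≡_; _≢_; refl; sym; trans; cong; subst)

swapAtom-≡ˡ : ∀ {a b c} → c ≡ a → swapAtom a b c ≡ b
swapAtom-≡ˡ {a} {b} {c} c≡a with c ≟ a
... | yes _   = refl
... | no c≢a = contradiction c≡a c≢a

swapAtom-≡ʳ : ∀ {a b c} → c ≡ b → swapAtom a b c ≡ a
swapAtom-≡ʳ {a} {b} {c} c≡b with c ≟ a
... | yes c≡a = trans (sym c≡b) c≡a
... | no _ with c ≟ b
...   | yes _   = refl
...   | no c≢b = contradiction c≡b c≢b

swapAtom-≢ : ∀ {a b c} → c ≢ a → c ≢ b → swapAtom a b c ≡ c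
swapAtom-≢ {a} {b} {c} c≢a c≢b with c ≟ a
... | yes c≡a = contradiction c≡a c≢a
... | no _ with c ≟ b
...   | yes c≡b = contradiction c≡b c≢b
...   | no _    = refl

swapAtom-involutive : ∀ a b c → swapAtom a b (swapAtom a b c) ≡ c
swapAtom-involutive a b c with c ≟ a
... | yes refl = swapAtom-≡ʳ {a} {b} {b} refl
... | no c≢a with c ≟ b
...   | yes refl = swapAtom-≡ˡ {a} {b} {a} refl
...   | no c≢b   = swapAtom-≢ c≢a c≢b

module _ {S : Signature} where

  mutual
    FreeIn-permG : ∀ {p q : Atom → Atom} → (∀ c → q (p c) ≡ c) → (∀ c → p (q c) ≡ c) →
                   ∀ a t → FreeIn S a (permG S p t) ⇔ FreeIn S (q a) t
    FreeIn-permG {p} {q} qp pq a (gatm c) = mk⇔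
      (λ { free-atm → subst (λ x → FreeIn S x (gatm c)) (sym (qp c)) free-atm })
      (λ { free-atm → subst (λ x → FreeIn S x (gatm (p (q a)))) (pq a) free-atm })
    FreeIn-permG qp pq a (gfn f ts) = mk⇔
      (λ { (free-fn v) → free-fn (Equivalence.to (FreeInVec-permGs qp pq a ts) v) })
      (λ { (free-fn v) → free-fn (Equivalence.from (FreeInVec-permGs qp pq a ts) v) })
    FreeIn-permG {p} {q} qp pq a (glam b t) = mk⇔
      (λ { (free-lam a≢pb v) → free-lam (λ qa≡b → a≢pb (trans (sym (pq a)) (cong p qa≡b)))
                                         (Equivalence.to (FreeIn-permG qp pq a t) v) })
      (λ { (free-lam qa≢b v) → free-lam (λ a≡pb → qa≢b (trans (cong q a≡pb) (qp b)))
                                         (Equivalence.from (FreeIn-permG qp pq a t) v) })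

    FreeInVec-permGs : ∀ {p q : Atom → Atom} → (∀ c → q (p c) ≡ c) → (∀ c → p (q c) ≡ c) →
                       ∀ a {n} (ts : Vec (Ground S) n) →
                       FreeInVec S a (permGs S p ts) ⇔ FreeInVec S (q a) ts
    FreeInVec-permGs qp pq a [] = mk⇔ (λ ()) (λ ())
    FreeInVec-permGs qp pq a (t ∷ ts) = mk⇔
      (λ { (here v) → here (Equivalence.to (FreeIn-permG qp pq a t) v)
         ; (there v) → there (Equivalence.to (FreeInVec-permGs qp pq a ts) v) })
      (λ { (here v) → here (Equivalence.from (FreeIn-permG qp pq a t) v)
         ; (there v) → there (Equivalence.from (FreeInVec-permGs qp pq a ts) v) })

  #g-permG : ∀ {p q : Atom → Atom} → (∀ c → q (p c) ≡ c) → (∀ c → p (q c) ≡ c) →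
             ∀ a t → _#g_ S a (permG S p t) ⇔ _#g_ S (q a) t
  #g-permG qp pq a t = ¬-cong-⇔ (FreeIn-permG qp pq a t)

  #g-gatm : ∀ {a b} → _#g_ S a (gatm b) ⇔ (a ≢ b)
  #g-gatm = mk⇔ (λ { a#b refl → a#b free-atm }) (λ { a≢b free-atm → a≢b refl })

  #g-glam : ∀ {a b t} → _#g_ S a (glam b t) ⇔ (a ≡ b ⊎ _#g_ S a t)
  #g-glam {a} {b} = mk⇔ to (λ { (inj₁ a≡b) (free-lam a≢b _) → a≢b a≡b
                              ; (inj₂ a#t) (free-lam _ v) → a#t v })
    where
    to : ∀ {t} → _#g_ S a (glam b t) → a ≡ b ⊎ _#g_ S a t
    to a#λbt with a ≟ b
    ... | yes a≡b = inj₁ a≡b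
    ... | no a≢b  = inj₂ (a#λbt ∘ free-lam a≢b)

  #g-glam-self : ∀ {a b} → _#g_ S a (glam b (gatm a)) ⇔ (a ≡ b)
  #g-glam-self = ⇔.trans #g-glam
    (mk⇔ (λ { (inj₁ a≡b) → a≡b ; (inj₂ a#a) → ⊥-elim (a#a free-atm) }) inj₁)

  #g-gfn : ∀ {a f} {ts : Vec (Ground S) (arity S f)} → _#g_ S a (gfn f ts) ⇔ (¬ FreeInVec S a ts)
  #g-gfn = mk⇔ (λ a#fts v → a#fts (free-fn v)) (λ { a#ts (free-fn v) → a#ts v })

  ¬FreeInVec-∷ : ∀ {a n t} {ts : Vec (Ground S) n} →
                 (¬ FreeInVec S a (t ∷ ts)) ⇔ (_#g_ S a t × ¬ FreeInVec S a ts)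
  ¬FreeInVec-∷ = mk⇔ (λ a#tts → a#tts ∘ here , a#tts ∘ there)
                     (λ { (a#t , a#ts) (here v) → a#t v ; (a#t , a#ts) (there v) → a#ts v })

module _ (S : Signature) where

  ⟦_⟧⁻¹ : Perm → Interp S → Atom → Atom
  ⟦ idπ ⟧⁻¹ ρ c = c
  ⟦ swap∘ W₁ W₂ π ⟧⁻¹ ρ c = ⟦ π ⟧⁻¹ ρ (swapAtom (⟦_⟧ᵃ S W₁ ρ) (⟦_⟧ᵃ S W₂ ρ) c)

  ⟦⟧⁻¹-inverseˡ : ∀ π ρ c → ⟦ π ⟧⁻¹ ρ (⟦_⟧ᵖ S π ρ c) ≡ c
  ⟦⟧⁻¹-inverseˡ idπ ρ c = refl
  ⟦⟧⁻¹-inverseˡ (swap∘ W₁ W₂ π) ρ c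
    rewrite swapAtom-involutive (⟦_⟧ᵃ S W₁ ρ) (⟦_⟧ᵃ S W₂ ρ) (⟦_⟧ᵖ S π ρ c) = ⟦⟧⁻¹-inverseˡ π ρ c

  ⟦⟧⁻¹-inverseʳ : ∀ π ρ c → ⟦_⟧ᵖ S π ρ (⟦ π ⟧⁻¹ ρ c) ≡ c
  ⟦⟧⁻¹-inverseʳ idπ ρ c = refl
  ⟦⟧⁻¹-inverseʳ (swap∘ W₁ W₂ π) ρ c
    rewrite ⟦⟧⁻¹-inverseʳ π ρ (swapAtom (⟦_⟧ᵃ S W₁ ρ) (⟦_⟧ᵃ S W₂ ρ) c) =
      swapAtom-involutive (⟦_⟧ᵃ S W₁ ρ) (⟦_⟧ᵃ S W₂ ρ) c

  DNF : Set
  DNF = List (SimpleCtx S)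

  ⊤ᵈ : DNF
  ⊤ᵈ = [ [] ]

  infixr 6 _∧_
  infixr 5 _∨_

  -- Opaque, so that Sat-∨ and Sat-∧ can infer their arguments.
  opaque
    _∨_ _∧_ : DNF → DNF → DNF
    _∨_ = _++_
    _∧_ = cartesianProductWith _++_

  literal : SimpleConstraint S → DNF
  literal c = [ [ c ] ]

  _≈_ _≉_ : AVar → AVar → DNF
  A ≈ B = literal (av#lam A B)
  A ≉ B = literal (av#av A B)

  _#ᵛ_ : AVar → TVar → DNF
  A #ᵛ X = literal (av#tv A X)

  ifEq : AVar → AVar → DNF → DNF → DNF
  ifEq A B Φ Ψ = A ≈ B ∧ Φ ∨ A ≉ B ∧ Ψ

  swapVars : AVar → AVar → (AVar → DNF) → AVar → DNF
  swapVars A B k C = ifEq C A (k B) (ifEq C B (k A) (k C))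

  -- A continuation k : AVar → DNF stands for a DNF with a hole for an atom;
  -- bindSusp W k fills the hole with the value of W, by case analysis on
  -- which atom-variable of W that value is.
  mutual
    bindSusp : ASusp → (AVar → DNF) → DNF
    bindSusp (π ·ᵃ A) k = permute π k A

    permute : Perm → (AVar → DNF) → AVar → DNF
    permute idπ k = k
    permute (swap∘ W₁ W₂ π) k = permute π (swapSusps W₁ W₂ k)

    swapSusps : ASusp → ASusp → (AVar → DNF) → AVar → DNF
    swapSusps W₁ W₂ k C = bindSusp W₁ (λ A → bindSusp W₂ (λ B → swapVars A B k C))

  unpermute : Perm → (AVar → DNF) → AVar → DNF
  unpermute idπ k = k
  unpermute (swap∘ W₁ W₂ π) k = swapSusps W₁ W₂ (unpermute π k)

  mutual
    fresh : AVar → Term S → DNF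
    fresh A (atm W)   = bindSusp W (A ≉_)
    fresh A (sus π X) = unpermute π (_#ᵛ X) A
    fresh A (fn f ss) = freshAll A ss
    fresh A (lam W s) = bindSusp W (λ B → A ≈ B ∨ fresh A s)

    freshAll : AVar → ∀ {n} → Vec (Term S) n → DNF
    freshAll A []       = ⊤ᵈ
    freshAll A (s ∷ ss) = fresh A s ∧ freshAll A ss

  constraint : Constraint S → DNF
  constraint (W # s) = bindSusp W (λ A → fresh A s)

  context : FreshCtx S → DNF
  context []      = ⊤ᵈ
  context (c ∷ ∇) = constraint c ∧ context ∇

  module _ (ρ : Interp S) where

    Sat : DNF → Set
    Sat = Any (λ ∇ → Holds S (toCtx S ∇) ρ)

    Holds-toCtx-++ : ∀ ∇₁ ∇₂ → Holds S (toCtx S (∇₁ ++ ∇₂)) ρ ⇔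
                               (Holds S (toCtx S ∇₁) ρ × Holds S (toCtx S ∇₂) ρ)
    Holds-toCtx-++ ∇₁ ∇₂ rewrite map-++ (embed S) ∇₁ ∇₂ = ⇔.sym (↔⇒⇔ All.++↔)

    Sat-⊤ : Sat ⊤ᵈ
    Sat-⊤ = here []

    opaque
      unfolding _∨_ _∧_

      Sat-∨ : ∀ {Φ Ψ} → Sat (Φ ∨ Ψ) ⇔ (Sat Φ ⊎ Sat Ψ)
      Sat-∨ = ⇔.sym (↔⇒⇔ Any.++↔)

      Sat-∧ : ∀ {Φ Ψ} → Sat (Φ ∧ Ψ) ⇔ (Sat Φ × Sat Ψ)
      Sat-∧ {Φ} {Ψ} = mk⇔
        (Any.cartesianProductWith⁻ _++_ (Equivalence.to (Holds-toCtx-++ _ _)) Φ Ψ)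
        (λ (sΦ , sΨ) → Any.cartesianProductWith⁺ _++_
                         (λ h₁ h₂ → Equivalence.from (Holds-toCtx-++ _ _) (h₁ , h₂)) sΦ sΨ)

    Sat-literal : ∀ c → Sat (literal c) ⇔ HoldsC S (embed S c) ρ
    Sat-literal _ = mk⇔ (λ { (here (h ∷ [])) → h }) (λ h → here (h ∷ []))

    Sat-≈ : ∀ A B → Sat (A ≈ B) ⇔ (atomI ρ A ≡ atomI ρ B)
    Sat-≈ A B = ⇔.trans (Sat-literal _) #g-glam-self

    Sat-≉ : ∀ A B → Sat (A ≉ B) ⇔ (atomI ρ A ≢ atomI ρ B)
    Sat-≉ A B = ⇔.trans (Sat-literal _) #g-gatm

    Sat-#ᵛ : ∀ A X → Sat (A #ᵛ X) ⇔ _#g_ S (atomI ρ A) (termI ρ X)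
    Sat-#ᵛ A X = ⇔.trans (Sat-literal _) (#g-permG (λ _ → refl) (λ _ → refl) _ _)

    Sat-ifEq : ∀ A B Φ Ψ → Sat (ifEq A B Φ Ψ) ⇔
               (atomI ρ A ≡ atomI ρ B × Sat Φ ⊎ atomI ρ A ≢ atomI ρ B × Sat Ψ)
    Sat-ifEq A B _ _ = ⇔.trans Sat-∨
      (⇔.trans Sat-∧ (Sat-≈ A B ×-⇔ ⇔.refl) ⊎-⇔ ⇔.trans Sat-∧ (Sat-≉ A B ×-⇔ ⇔.refl))

    Sat-ifEq-≡ : ∀ {A B Φ Ψ} → atomI ρ A ≡ atomI ρ B → Sat (ifEq A B Φ Ψ) ⇔ Sat Φ
    Sat-ifEq-≡ A≡B = ⇔.trans (Sat-ifEq _ _ _ _)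
      (mk⇔ [ proj₂ , (λ (A≢B , _) → ⊥-elim (A≢B A≡B)) ]′ (λ sΦ → inj₁ (A≡B , sΦ)))

    Sat-ifEq-≢ : ∀ {A B Φ Ψ} → atomI ρ A ≢ atomI ρ B → Sat (ifEq A B Φ Ψ) ⇔ Sat Ψ
    Sat-ifEq-≢ A≢B = ⇔.trans (Sat-ifEq _ _ _ _)
      (mk⇔ [ (λ (A≡B , _) → ⊥-elim (A≢B A≡B)) , proj₂ ]′ (λ sΨ → inj₂ (A≢B , sΨ)))

    record Expresses (k : AVar → DNF) (P : Atom → Set) : Set where
      constructor expresses
      field at : ∀ A → Sat (k A) ⇔ P (atomI ρ A)
    open Expresses

    swapVars-expresses : ∀ {k P} A B → Expresses k P →
                         Expresses (swapVars A B k) (P ∘ swapAtom (atomI ρ A) (atomI ρ B))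
    at (swapVars-expresses A B hk) C with atomI ρ C ≟ atomI ρ A
    ... | yes C≡A = ⇔.trans (Sat-ifEq-≡ C≡A) (at hk B)
    ... | no C≢A with atomI ρ C ≟ atomI ρ B
    ...   | yes C≡B = ⇔.trans (Sat-ifEq-≢ C≢A) (⇔.trans (Sat-ifEq-≡ C≡B) (at hk A))
    ...   | no C≢B  = ⇔.trans (Sat-ifEq-≢ C≢A) (⇔.trans (Sat-ifEq-≢ C≢B) (at hk C))

    mutual
      bindSusp-expresses : ∀ W {k P} → Expresses k P → Sat (bindSusp W k) ⇔ P (⟦_⟧ᵃ S W ρ)
      bindSusp-expresses (π ·ᵃ A) hk = at (permute-expresses π hk) A

      permute-expresses : ∀ π {k P} → Expresses k P → Expresses (permute π k) (P ∘ ⟦_⟧ᵖ S π ρ)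
      permute-expresses idπ hk = hk
      permute-expresses (swap∘ W₁ W₂ π) hk = permute-expresses π (swapSusps-expresses W₁ W₂ hk)

      swapSusps-expresses : ∀ W₁ W₂ {k P} → Expresses k P →
                            Expresses (swapSusps W₁ W₂ k) (P ∘ swapAtom (⟦_⟧ᵃ S W₁ ρ) (⟦_⟧ᵃ S W₂ ρ))
      at (swapSusps-expresses W₁ W₂ {P = P} hk) C =
        bindSusp-expresses W₁ {P = λ a → P (swapAtom a (⟦_⟧ᵃ S W₂ ρ) (atomI ρ C))} (expresses λ A →
          bindSusp-expresses W₂ {P = λ b → P (swapAtom (atomI ρ A) b (atomI ρ C))} (expresses λ B →
            at (swapVars-expresses A B hk) C))

    unpermute-expresses : ∀ π {k P} → Expresses k P → Expresses (unpermute π k) (P ∘ ⟦ π ⟧⁻¹ ρ)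
    unpermute-expresses idπ hk = hk
    unpermute-expresses (swap∘ W₁ W₂ π) hk = swapSusps-expresses W₁ W₂ (unpermute-expresses π hk)

    mutual
      Sat-fresh : ∀ A s → Sat (fresh A s) ⇔ _#g_ S (atomI ρ A) (⟦_⟧ S s ρ)
      Sat-fresh A (atm W) =
        bindSusp-expresses W {P = λ b → _#g_ S (atomI ρ A) (gatm b)} (expresses (Sat-literal ∘ av#av A))
      Sat-fresh A (sus π X) = ⇔.trans
        (at (unpermute-expresses π {P = λ b → _#g_ S b (termI ρ X)} (expresses λ B → Sat-#ᵛ B X)) A)
        (⇔.sym (#g-permG (⟦⟧⁻¹-inverseˡ π ρ) (⟦⟧⁻¹-inverseʳ π ρ) _ _))
      Sat-fresh A (fn f ss) = ⇔.trans (Sat-freshAll A ss) (⇔.sym #g-gfn)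
      Sat-fresh A (lam W s) =
        bindSusp-expresses W {P = λ b → _#g_ S (atomI ρ A) (glam b (⟦_⟧ S s ρ))} (expresses λ B →
          ⇔.trans Sat-∨ (⇔.trans (Sat-≈ A B ⊎-⇔ Sat-fresh A s) (⇔.sym #g-glam)))

      Sat-freshAll : ∀ A {n} (ss : Vec (Term S) n) →
                     Sat (freshAll A ss) ⇔ (¬ FreeInVec S (atomI ρ A) (⟦_⟧ˢ S ss ρ))
      Sat-freshAll A []       = mk⇔ (λ _ ()) (λ _ → Sat-⊤)
      Sat-freshAll A (s ∷ ss) = ⇔.trans Sat-∧
        (⇔.trans (Sat-fresh A s ×-⇔ Sat-freshAll A ss) (⇔.sym ¬FreeInVec-∷))

    Sat-constraint : ∀ c → Sat (constraint c) ⇔ HoldsC S c ρ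
    Sat-constraint (W # s) =
      bindSusp-expresses W {P = λ a → _#g_ S a (⟦_⟧ S s ρ)} (expresses λ A → Sat-fresh A s)

    Sat-context : ∀ ∇ → Sat (context ∇) ⇔ Holds S ∇ ρ
    Sat-context []      = mk⇔ (λ _ → []) (λ _ → Sat-⊤)
    Sat-context (c ∷ ∇) = ⇔.trans Sat-∧
      (⇔.trans (Sat-constraint c ×-⇔ Sat-context ∇) (mk⇔ (uncurry _∷_) uncons))

mainTheorem4 : (S : Signature) (∇ : FreshCtx S) →
    Σ (List (SimpleCtx S)) (λ ∇s →
      (ρ : Interp S) → Holds S ∇ ρ ⇔ Any (λ ∇i → Holds S (toCtx S ∇i) ρ) ∇s)
mainTheorem4 S ∇ = context S ∇ , λ ρ → ⇔.sym (Sat-context S ρ ∇)
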